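{- Let $p$ be a prime and $s,g\geq1$ integers with $s\mid g$. Then $$s\,r\Big(\frac{2g}{s},p\Big)+v_p(s!)\leq r(2g,p).$$
   Context: For an integer $n\geq1$, $r(n,p)=\sum_{i\geq0}\lfloor n/(p^i(p-1))\rfloor$. -}

module Defs where

open import Data.Nat using (ℕ; zero; suc; _+_; _*_; _∸_; _^_; _/_)
open import Data.Nat.Divisibility using (_∣?_)
open import Relation.Nullary using (yes; no)

_÷_ : ℕ → ℕ → ℕ
n ÷ zero = 0
n ÷ suc d = n / suc d

rSum : ℕ → ℕ → ℕ → ℕ
rSum n p zero    = n ÷ (p ^ 0 * (p ∸ 1))
rSum n p (suc k) = rSum n p k + n ÷ (p ^ suc k * (p ∸ 1))

-- r(n,p) = Σ_{i≥0} ⌊ n / (p^i (p-1)) ⌋.  For p ≥ 2 we have p^i (p-1) ≥ 2^i > n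
-- whenever i > n, so all terms with i > n vanish and truncating at i = n is exact.
r : ℕ → ℕ → ℕ
r n p = rSum n p n

-- p-adic valuation v_p(m): number of times p divides m (with fuel);
-- v_p(0) = 0 by convention (not used: we only apply it to s! ≥ 1).
-- With fuel m and p ≥ 2, the fuel never runs out for m ≥ 1.
vAux : ℕ → ℕ → ℕ → ℕ
vAux p m zero = 0
vAux p zero (suc f) = 0
vAux p (suc m) (suc f) with p ∣? suc m
... | yes _ = suc (vAux p (suc m ÷ p) f)
... | no  _ = 0

v : ℕ → ℕ → ℕ
v p m = vAux p m m

-- Writing 2g = s n, it suffices that s r(n,p) + v_p(s!) ≤ r(sn,p) for every n ≥ 1.
-- Put δ i = p^i (p - 1) and pick i₀ with n < δ i₀ ≤ p n.  The terms of r(n,p) vanish from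
-- i₀ on, and s ⌊n/δ i⌋ ≤ ⌊sn/δ i⌋ for i < i₀.
module Submission where

open import Data.Nat.Base
open import Data.Nat.Properties
open import Data.Nat.DivMod
open import Data.Nat.Divisibility
open import Data.Nat.Primality using (Prime; euclidsLemma; prime⇒nonTrivial)
open import Data.Product.Base using (∃-syntax; _×_; _,_)
open import Data.Sum.Base using ([_,_]′)
open import Function.Base using (_∘_)
open import Relation.Nullary using (¬_; yes; no; contradiction)
open import Relation.Binary.PropositionalEquality
open import Defs

÷≡/ : ∀ m d .{{_ : NonZero d}} → m ÷ d ≡ m / d
÷≡/ m (suc d) = refl

÷-monoˡ-≤ : ∀ {m n} d → m ≤ n → m ÷ d ≤ n ÷ d
÷-monoˡ-≤ zero    m≤n = z≤n
÷-monoˡ-≤ (suc d) m≤n = /-monoˡ-≤ (suc d) m≤n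

m<n⇒m÷n≡0 : ∀ {m n} → m < n → m ÷ n ≡ 0
m<n⇒m÷n≡0 {n = suc n} m<n = m<n⇒m/n≡0 m<n

m*n≤o⇒m≤o÷n : ∀ m {n o} → 0 < n → m * n ≤ o → m ≤ o ÷ n
m*n≤o⇒m≤o÷n m {suc n} _ m*n≤o = ≤-trans (≤-reflexive (sym (m*n/n≡m m (suc n)))) (/-monoˡ-≤ (suc n) m*n≤o)

m*[n÷o]≤m*n÷o : ∀ m n o → m * (n ÷ o) ≤ (m * n) ÷ o
m*[n÷o]≤m*n÷o m n zero    = ≤-reflexive (*-zeroʳ m)
m*[n÷o]≤m*n÷o m n (suc o) = m*n≤o⇒m≤o÷n (m * (n / suc o)) z<s
  (≤-trans (≤-reflexive (*-assoc m (n / suc o) (suc o))) (*-monoʳ-≤ m (m/n*n≤m n (suc o))))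

m÷n*n≤m : ∀ m n → (m ÷ n) * n ≤ m
m÷n*n≤m m zero    = z≤n
m÷n*n≤m m (suc n) = m/n*n≤m m (suc n)

m*n÷n≡m : ∀ m {n} → 0 < n → (m * n) ÷ n ≡ m
m*n÷n≡m m {suc n} _ = m*n/n≡m m (suc n)

m÷n<[1+m]÷n : ∀ m n → n ∣ suc m → m ÷ n < suc m ÷ n
m÷n<[1+m]÷n m zero    0∣1+m = contradiction (0∣⇒≡0 0∣1+m) λ ()
m÷n<[1+m]÷n m (suc n) n∣1+m = m<n*o⇒m/o<n (≤-reflexive (sym (m/n*n≡m n∣1+m)))

m+n≤1+n*m : ∀ {m n} → 0 < m → 0 < n → m + n ≤ suc (n * m)
m+n≤1+n*m {suc m} {suc n} _ _ = begin
  suc (m + suc n)         ≡⟨ cong suc (+-suc m n) ⟩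
  suc (suc (m + n))       ≤⟨ s≤s (s≤s (+-monoʳ-≤ m (m≤m*n n (suc m)))) ⟩
  suc (suc m + n * suc m) ∎
  where open ≤-Reasoning

^-monoʳ-∣ : ∀ m {e f} → e ≤ f → m ^ e ∣ m ^ f
^-monoʳ-∣ m {e} {f} e≤f = divides (m ^ (f ∸ e)) (begin
  m ^ f               ≡⟨ cong (m ^_) (m+[n∸m]≡n e≤f) ⟨
  m ^ (e + (f ∸ e))   ≡⟨ ^-distribˡ-+-* m e (f ∸ e) ⟩
  m ^ e * m ^ (f ∸ e) ≡⟨ *-comm (m ^ e) (m ^ (f ∸ e)) ⟩
  m ^ (f ∸ e) * m ^ e ∎)
  where open ≡-Reasoning

n<m^n : ∀ m n → 1 < m → n < m ^ n
n<m^n m zero    1<m = z<s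
n<m^n m (suc n) 1<m = begin-strict
  suc n         ≤⟨ n<m^n m n 1<m ⟩
  m ^ n         <⟨ m<m+n (m ^ n) (m^n>0 m n) ⟩
  m ^ n + m ^ n ≡⟨ cong (m ^ n +_) (+-identityʳ (m ^ n)) ⟨
  2 * m ^ n     ≤⟨ *-monoˡ-≤ (m ^ n) 1<m ⟩
  m ^ suc n     ∎
  where open ≤-Reasoning
        instance
          m≢0 : NonZero m
          m≢0 = >-nonZero (<-trans z<s 1<m)

sum< : ℕ → (ℕ → ℕ) → ℕ
sum< zero    f = 0
sum< (suc k) f = sum< k f + f k

infix 10 sum<
syntax sum< k (λ i → e) = ∑[ i < k ] e

sum<-mono-≤ : ∀ {f g} k → (∀ i → f i ≤ g i) → sum< k f ≤ sum< k g
sum<-mono-≤ zero    f≤g = z≤n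
sum<-mono-≤ (suc k) f≤g = +-mono-≤ (sum<-mono-≤ k f≤g) (f≤g k)

sum<-mono-< : ∀ {f g} k → (∀ {i} → i < k → f i < g i) → k + sum< k f ≤ sum< k g
sum<-mono-< zero    f<g = z≤n
sum<-mono-< {f} {g} (suc k) f<g = begin
  suc k + (sum< k f + f k) ≡⟨ cong suc (+-assoc k (sum< k f) (f k)) ⟨
  suc (k + sum< k f + f k) ≡⟨ +-suc (k + sum< k f) (f k) ⟨
  k + sum< k f + suc (f k) ≤⟨ +-mono-≤ (sum<-mono-< k (f<g ∘ m<n⇒m<1+n)) (f<g ≤-refl) ⟩
  sum< k g + g k           ∎
  where open ≤-Reasoning

*-distribˡ-sum< : ∀ m k f → m * sum< k f ≡ ∑[ i < k ] (m * f i)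
*-distribˡ-sum< m zero    f = *-zeroʳ m
*-distribˡ-sum< m (suc k) f =
  trans (*-distribˡ-+ m (sum< k f) (f k)) (cong (_+ m * f k) (*-distribˡ-sum< m k f))

sum<-split : ∀ j k f → sum< (j + k) f ≡ sum< j f + ∑[ t < k ] f (j + t)
sum<-split j zero    f = trans (cong (λ n → sum< n f) (+-identityʳ j)) (sym (+-identityʳ _))
sum<-split j (suc k) f = begin
  sum< (j + suc k) f                          ≡⟨ cong (λ n → sum< n f) (+-suc j k) ⟩
  sum< (j + k) f + f (j + k)                  ≡⟨ cong (_+ f (j + k)) (sum<-split j k f) ⟩
  sum< j f + ∑[ t < k ] f (j + t) + f (j + k) ≡⟨ +-assoc (sum< j f) _ (f (j + k)) ⟩
  sum< j f + ∑[ t < suc k ] f (j + t)         ∎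
  where open ≡-Reasoning

sum<-monoˡ-≤ : ∀ f {j k} → j ≤ k → sum< j f ≤ sum< k f
sum<-monoˡ-≤ f {j} {k} j≤k = begin
  sum< j f                                 ≤⟨ m≤m+n (sum< j f) _ ⟩
  sum< j f + ∑[ t < k ∸ j ] f (j + t)      ≡⟨ sum<-split j (k ∸ j) f ⟨
  sum< (j + (k ∸ j)) f                     ≡⟨ cong (λ n → sum< n f) (m+[n∸m]≡n j≤k) ⟩
  sum< k f                                 ∎
  where open ≤-Reasoning

sum<-zero : ∀ {f} k → (∀ i → f i ≡ 0) → sum< k f ≡ 0
sum<-zero zero    f≡0 = refl
sum<-zero (suc k) f≡0 = cong₂ _+_ (sum<-zero k f≡0) (f≡0 k)

sum<-vanishing : ∀ f {j k} → j ≤ k → (∀ {i} → j ≤ i → f i ≡ 0) → sum< k f ≡ sum< j f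
sum<-vanishing f {j} {k} j≤k f≡0 = begin
  sum< k f                              ≡⟨ cong (λ n → sum< n f) (m+[n∸m]≡n j≤k) ⟨
  sum< (j + (k ∸ j)) f                  ≡⟨ sum<-split j (k ∸ j) f ⟩
  sum< j f + ∑[ t < k ∸ j ] f (j + t)   ≡⟨ cong (sum< j f +_) (sum<-zero (k ∸ j) (λ t → f≡0 (m≤m+n j t))) ⟩
  sum< j f + 0                          ≡⟨ +-identityʳ (sum< j f) ⟩
  sum< j f                              ∎
  where open ≡-Reasoning

sum<-mono-prefix-< : ∀ {f g} e k → e ≤ k → (∀ i → f i ≤ g i) → (∀ {i} → i < e → f i < g i) →
                     e + sum< k f ≤ sum< k g
sum<-mono-prefix-< {f} {g} e k e≤k f≤g f<g = begin
  e + sum< k f                                          ≡⟨ cong (λ n → e + sum< n f) (m+[n∸m]≡n e≤k) ⟨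
  e + sum< (e + (k ∸ e)) f                              ≡⟨ cong (e +_) (sum<-split e (k ∸ e) f) ⟩
  e + (sum< e f + ∑[ t < k ∸ e ] f (e + t))             ≡⟨ +-assoc e _ _ ⟨
  e + sum< e f + ∑[ t < k ∸ e ] f (e + t)               ≤⟨ +-mono-≤ (sum<-mono-< e f<g) (sum<-mono-≤ (k ∸ e) (f≤g ∘ (e +_))) ⟩
  sum< e g + ∑[ t < k ∸ e ] g (e + t)                   ≡⟨ sum<-split e (k ∸ e) g ⟨
  sum< (e + (k ∸ e)) g                                  ≡⟨ cong (λ n → sum< n g) (m+[n∸m]≡n e≤k) ⟩
  sum< k g                                              ∎
  where open ≤-Reasoning

vAux-≤-fuel : ∀ p m f → vAux p m f ≤ f
vAux-≤-fuel p m       zero    = z≤n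
vAux-≤-fuel p zero    (suc f) = z≤n
vAux-≤-fuel p (suc m) (suc f) with p ∣? suc m
... | yes _ = s≤s (vAux-≤-fuel p (suc m ÷ p) f)
... | no  _ = z≤n

v-≤ : ∀ p m → v p m ≤ m
v-≤ p m = vAux-≤-fuel p m m

infix 4 _^_∥_

record _^_∥_ (q e m : ℕ) : Set where
  constructor exactly
  field
    pow-∣     : q ^ e ∣ m
    pow-suc-∤ : ¬ q ^ suc e ∣ m

open _^_∥_

module _ (p : ℕ) .{{_ : NonTrivial p}} where

  private instance
    p≢0 : NonZero p
    p≢0 = nonTrivial⇒nonZero p

  ∥-*ˡ : ∀ {e k} → p ^ e ∥ k → p ^ suc e ∥ p * k
  ∥-*ˡ (exactly p^e∣k p^1+e∤k) = exactly (*-monoʳ-∣ p p^e∣k) (p^1+e∤k ∘ *-cancelˡ-∣ p)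

  ∥⇒maximal : ∀ {e e′ m} → p ^ e ∥ m → p ^ e′ ∣ m → e′ ≤ e
  ∥⇒maximal {e} {e′} (exactly _ p^1+e∤m) p^e′∣m with e′ ≤? e
  ... | yes e′≤e = e′≤e
  ... | no  e′≰e = contradiction (∣-trans (^-monoʳ-∣ p (≰⇒> e′≰e)) p^e′∣m) p^1+e∤m

  vAux-exact : ∀ f m .{{_ : NonZero m}} → m ≤ f → p ^ vAux p m f ∥ m
  vAux-exact (suc f) (suc m) (s≤s m≤f) with p ∣? suc m
  ... | no  p∤1+m = exactly (1∣ suc m) (p∤1+m ∘ subst (_∣ suc m) (*-identityʳ p))
  ... | yes p∣1+m rewrite ÷≡/ (suc m) p {{p≢0}} =
    subst (p ^ suc (vAux p k f) ∥_) (m*[n/m]≡n p∣1+m) (∥-*ˡ (vAux-exact f k k≤f))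
    where
      k : ℕ
      k = suc m / p
      instance
        k≢0 : NonZero k
        k≢0 = >-nonZero (m≥n⇒m/n>0 (∣⇒≤ p∣1+m))
      k≤f : k ≤ f
      k≤f = ≤-trans (<⇒≤pred (m/n<m (suc m) p (nonTrivial⇒n>1 p))) m≤f

  v-exact : ∀ m .{{_ : NonZero m}} → p ^ v p m ∥ m
  v-exact m = vAux-exact m m ≤-refl

  ∥⇒cofactor : ∀ {e m} → p ^ e ∥ m → ∃[ m′ ] m ≡ m′ * p ^ e × ¬ p ∣ m′
  ∥⇒cofactor {e} (exactly (divides m′ m≡m′*p^e) p^1+e∤m) =
    m′ , m≡m′*p^e , p^1+e∤m ∘ subst (p ^ suc e ∣_) (sym m≡m′*p^e) ∘ *-monoˡ-∣ (p ^ e)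

  ∥-* : Prime p → ∀ {α β a b} → p ^ α ∥ a → p ^ β ∥ b → p ^ (α + β) ∥ a * b
  ∥-* prime {α} {β} {a} {b} p^α∥a p^β∥b with ∥⇒cofactor p^α∥a | ∥⇒cofactor p^β∥b
  ... | a′ , a≡a′*p^α , p∤a′ | b′ , b≡b′*p^β , p∤b′ = exactly p^[α+β]∣ab p^[1+α+β]∤ab
    where
      ab≡ : a * b ≡ p ^ (α + β) * (a′ * b′)
      ab≡ = begin
        a * b                         ≡⟨ cong₂ _*_ a≡a′*p^α b≡b′*p^β ⟩
        a′ * p ^ α * (b′ * p ^ β)     ≡⟨ [m*n]*[o*p]≡[m*o]*[n*p] a′ (p ^ α) b′ (p ^ β) ⟩
        a′ * b′ * (p ^ α * p ^ β)     ≡⟨ *-comm (a′ * b′) _ ⟩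
        p ^ α * p ^ β * (a′ * b′)     ≡⟨ cong (_* (a′ * b′)) (^-distribˡ-+-* p α β) ⟨
        p ^ (α + β) * (a′ * b′)       ∎
        where open ≡-Reasoning

      p^[α+β]∣ab : p ^ (α + β) ∣ a * b
      p^[α+β]∣ab = subst (p ^ (α + β) ∣_) (sym ab≡) (m∣m*n (a′ * b′))

      p^[1+α+β]∤ab : ¬ p ^ suc (α + β) ∣ a * b
      p^[1+α+β]∤ab p^[1+α+β]∣ab = [ p∤a′ , p∤b′ ]′ (euclidsLemma a′ b′ prime
        (*-cancelˡ-∣ (p ^ (α + β)) {{m^n≢0 p (α + β)}} (subst₂ _∣_ (*-comm p (p ^ (α + β))) ab≡ p^[1+α+β]∣ab)))

  v-*-≤ : Prime p → ∀ a b .{{_ : NonZero a}} .{{_ : NonZero b}} → v p (a * b) ≤ v p a + v p b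
  v-*-≤ prime a b = ∥⇒maximal (∥-* prime (v-exact a) (v-exact b)) (pow-∣ (v-exact (a * b) {{m*n≢0 a b}}))

  v-1 : v p 1 ≡ 0
  v-1 with p ∣? 1
  ... | yes p∣1 = contradiction (∣1⇒≡1 p∣1) (nonTrivial⇒≢1 {p})
  ... | no  _   = refl

  legendre-≤ : Prime p → ∀ s K → s ≤ K → v p (s !) ≤ ∑[ t < K ] (s ÷ (p ^ suc t))
  legendre-≤ prime zero    K _   = ≤-trans (≤-reflexive v-1) z≤n
  legendre-≤ prime (suc s) K s<K = begin
    v p (suc s * s !)                           ≤⟨ v-*-≤ prime (suc s) (s !) {{_}} {{s !≢0}} ⟩
    v p (suc s) + v p (s !)                     ≤⟨ +-monoʳ-≤ (v p (suc s)) (legendre-≤ prime s K (<⇒≤ s<K)) ⟩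
    v p (suc s) + ∑[ t < K ] (s ÷ (p ^ suc t))  ≤⟨ sum<-mono-prefix-< (v p (suc s)) K v≤K floor-mono floor-jumps ⟩
    ∑[ t < K ] (suc s ÷ (p ^ suc t))            ∎
    where
      open ≤-Reasoning
      -- ⌊s/p^(t+1)⌋ jumps at s + 1 for each of the v p (s + 1) exponents with p^(t+1) ∣ s + 1.
      v≤K : v p (suc s) ≤ K
      v≤K = ≤-trans (v-≤ p (suc s)) s<K
      floor-mono : ∀ t → s ÷ (p ^ suc t) ≤ suc s ÷ (p ^ suc t)
      floor-mono t = ÷-monoˡ-≤ (p ^ suc t) (n≤1+n s)
      floor-jumps : ∀ {t} → t < v p (suc s) → s ÷ (p ^ suc t) < suc s ÷ (p ^ suc t)
      floor-jumps {t} t<v = m÷n<[1+m]÷n s (p ^ suc t) (∣-trans (^-monoʳ-∣ p t<v) (pow-∣ (v-exact (suc s))))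

  δ : ℕ → ℕ
  δ i = p ^ i * (p ∸ 1)

  private
    p∸1>0 : 0 < p ∸ 1
    p∸1>0 = m<n⇒0<n∸m (nonTrivial⇒n>1 p)

  δ>0 : ∀ i → 0 < δ i
  δ>0 i = *-mono-≤ (m^n>0 p i) p∸1>0

  δ-mono-≤ : ∀ {i j} → i ≤ j → δ i ≤ δ j
  δ-mono-≤ i≤j = *-monoˡ-≤ (p ∸ 1) (^-monoʳ-≤ p i≤j)

  n<δn : ∀ n → n < δ n
  n<δn n = <-≤-trans (n<m^n p n (nonTrivial⇒n>1 p)) (m≤m*n (p ^ n) (p ∸ 1) {{>-nonZero p∸1>0}})

  δ-+ : ∀ i t → δ (i + t) ≡ p ^ t * δ i
  δ-+ i t = begin
    p ^ (i + t) * (p ∸ 1)       ≡⟨ cong (_* (p ∸ 1)) (trans (^-distribˡ-+-* p i t) (*-comm (p ^ i) (p ^ t))) ⟩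
    p ^ t * p ^ i * (p ∸ 1)     ≡⟨ *-assoc (p ^ t) (p ^ i) (p ∸ 1) ⟩
    p ^ t * δ i                 ∎
    where open ≡-Reasoning

  rSum≡sum : ∀ n k → rSum n p k ≡ ∑[ i < suc k ] (n ÷ δ i)
  rSum≡sum n zero    = refl
  rSum≡sum n (suc k) = cong (_+ n ÷ δ (suc k)) (rSum≡sum n k)

  r≡sum< : ∀ n {j} → n < δ j → j ≤ suc n → r n p ≡ ∑[ i < j ] (n ÷ δ i)
  r≡sum< n n<δj j≤1+n = trans (rSum≡sum n n)
    (sum<-vanishing (λ i → n ÷ δ i) j≤1+n (λ j≤i → m<n⇒m÷n≡0 (<-≤-trans n<δj (δ-mono-≤ j≤i))))

  sum<≤r : ∀ n {j} → j ≤ suc n → ∑[ i < j ] (n ÷ δ i) ≤ r n p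
  sum<≤r n j≤1+n = ≤-trans (sum<-monoˡ-≤ (λ i → n ÷ δ i) j≤1+n) (≤-reflexive (sym (rSum≡sum n n)))

  δ-threshold : ∀ {n} → 0 < n → ∀ k → n < δ k → ∃[ i ] i ≤ k × n < δ i × δ i ≤ p * n
  δ-threshold {n} n>0 zero n<δ0 = 0 , z≤n , n<δ0 , (begin
    1 * (p ∸ 1) ≡⟨ *-identityˡ (p ∸ 1) ⟩
    p ∸ 1       ≤⟨ m∸n≤m p 1 ⟩
    p           ≤⟨ m≤m*n p n {{>-nonZero n>0}} ⟩
    p * n       ∎)
    where open ≤-Reasoning
  δ-threshold n>0 (suc k) n<δ[1+k] with _ <? δ k
  ... | yes n<δk = let i , i≤k , rest = δ-threshold n>0 k n<δk in i , m≤n⇒m≤1+n i≤k , rest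
  ... | no  n≮δk = suc k , ≤-refl , n<δ[1+k] ,
    ≤-trans (≤-reflexive (*-assoc p (p ^ k) (p ∸ 1))) (*-monoʳ-≤ p (≮⇒≥ n≮δk))

  s÷p^[1+t]≤sn÷δ[i+t] : ∀ s n i → δ i ≤ p * n → ∀ t → s ÷ (p ^ suc t) ≤ (s * n) ÷ δ (i + t)
  s÷p^[1+t]≤sn÷δ[i+t] s n i δi≤pn t = m*n≤o⇒m≤o÷n x (δ>0 (i + t)) (begin
    x * δ (i + t)            ≡⟨ cong (x *_) (δ-+ i t) ⟩
    x * (p ^ t * δ i)        ≤⟨ *-monoʳ-≤ x (*-monoʳ-≤ (p ^ t) δi≤pn) ⟩
    x * (p ^ t * (p * n))    ≡⟨ cong (x *_) (*-assoc (p ^ t) p n) ⟨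
    x * (p ^ t * p * n)      ≡⟨ cong (λ y → x * (y * n)) (*-comm (p ^ t) p) ⟩
    x * (p ^ suc t * n)      ≡⟨ *-assoc x (p ^ suc t) n ⟨
    x * p ^ suc t * n        ≤⟨ *-monoˡ-≤ n (m÷n*n≤m s (p ^ suc t)) ⟩
    s * n                    ∎)
    where
      open ≤-Reasoning
      x : ℕ
      x = s ÷ (p ^ suc t)

  r-scaling : Prime p → ∀ s n → 0 < s → 0 < n → s * r n p + v p (s !) ≤ r (s * n) p
  r-scaling prime s n s>0 n>0 with δ-threshold n>0 n (n<δn n)
  ... | i , i≤n , n<δi , δi≤pn = begin
    s * r n p + v p (s !)                              ≡⟨ cong (λ x → s * x + v p (s !)) (r≡sum< n n<δi (m≤n⇒m≤1+n i≤n)) ⟩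
    s * ∑[ j < i ] (n ÷ δ j) + v p (s !)               ≡⟨ cong (_+ v p (s !)) (*-distribˡ-sum< s i (λ j → n ÷ δ j)) ⟩
    ∑[ j < i ] (s * (n ÷ δ j)) + v p (s !)             ≤⟨ +-mono-≤ (sum<-mono-≤ i (λ j → m*[n÷o]≤m*n÷o s n (δ j)))
                                                                   (legendre-≤ prime s s ≤-refl) ⟩
    ∑[ j < i ] (N ÷ δ j) + ∑[ t < s ] (s ÷ (p ^ suc t)) ≤⟨ +-monoʳ-≤ (∑[ j < i ] (N ÷ δ j))
                                                                    (sum<-mono-≤ s (s÷p^[1+t]≤sn÷δ[i+t] s n i δi≤pn)) ⟩
    ∑[ j < i ] (N ÷ δ j) + ∑[ t < s ] (N ÷ δ (i + t))  ≡⟨ sum<-split i s (λ j → N ÷ δ j) ⟨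
    ∑[ j < i + s ] (N ÷ δ j)                           ≤⟨ sum<≤r N i+s≤1+N ⟩
    r N p                                              ∎
    where
      open ≤-Reasoning
      N : ℕ
      N = s * n
      i+s≤1+N : i + s ≤ suc N
      i+s≤1+N = ≤-trans (+-monoˡ-≤ s i≤n) (m+n≤1+n*m n>0 s>0)

mainTheorem20 : (p s g : ℕ) → Prime p → 1 ≤ s → 1 ≤ g → s ∣ g →
                s * r ((2 * g) ÷ s) p + v p (s !) ≤ r (2 * g) p
mainTheorem20 p s g prime s>0 g>0 s∣g =
  subst₂ (λ k N → s * r k p + v p (s !) ≤ r N p) (sym 2g÷s≡k) s*k≡2g
    (r-scaling p {{prime⇒nonTrivial prime}} prime s k s>0 k>0)
  where
    s∣2g : s ∣ 2 * g
    s∣2g = ∣n⇒∣m*n 2 s∣g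
    k : ℕ
    k = quotient s∣2g
    2g÷s≡k : (2 * g) ÷ s ≡ k
    2g÷s≡k = trans (cong (_÷ s) (m∣n⇒n≡quotient*m s∣2g)) (m*n÷n≡m k s>0)
    s*k≡2g : s * k ≡ 2 * g
    s*k≡2g = sym (m∣n⇒n≡m*quotient s∣2g)
    k>0 : 0 < k
    k>0 = >-nonZero⁻¹ k {{quotient≢0 s∣2g {{m*n≢0 2 g {{_}} {{>-nonZero g>0}}}}}}
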